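{- Let $\mathfrak L$ and $\mathfrak L'$ be languages with value domains $\mathbb V$ and $\mathbb V'$, let $\sim$ be an equivalence relation on a class $\mathbb Z$ with $\mathbb V,\mathbb V'\subseteq\mathbb Z$, and let $\mathcal T$ be a translation from $\mathfrak L$ into $\mathfrak L'$ that is correct up to $\sim$. Then $\sim$ is a congruence for $\mathcal T(\mathfrak L)$.
   Context: Fix a set $\mathcal V$ of variables. A language $\mathfrak L$ consists of a set $\mathbb T_{\mathfrak L}$ of expressions built from variables in $\mathcal V$ by means of operators (and possibly recursion constructs), a domain of values $\mathbb V$, and a semantic mapping $[\![\cdot]\!]_{\mathfrak L}:\mathbb T_{\mathfrak L}\to((\mathcal V\to\mathbb V)\to\mathbb V)$; a function $\rho:\mathcal V\to\mathbb V$ is called a valuation. Two valuations $\eta,\rho:\mathcal V\to\mathbb Z$ are $\sim$-equivalent, $\eta\sim\rho$, if $\eta(X)\sim\rho(X)$ for all $X\in\mathcal V$. A translation from $\mathfrak L$ into $\mathfrak L'$ is any map $\mathcal T:\mathbb T_{\mathfrak L}\to\mathbb T_{\mathfrak L'}$. It is correct up to $\sim$ if (i) for every $v\in\mathbb V$ there is $v'\in\mathbb V'$ with $v'\sim v$, and (ii) $[\![\mathcal T(E)]\!]_{\mathfrak L'}(\eta)\sim[\![E]\!]_{\mathfrak L}(\rho)$ for all $E\in\mathbb T_{\mathfrak L}$ and all valuations $\eta:\mathcal V\to\mathbb V'$, $\rho:\mathcal V\to\mathbb V$ with $\eta\sim\rho$. Let $\mathbb U:=\{v'\in\mathbb V'\mid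 \exists v\in\mathbb V.\ v'\sim v\}$. The relation $\sim$ is a congruence for $\mathcal T(\mathfrak L)$ if $[\![\mathcal T(E)]\!]_{\mathfrak L'}(\nu)\sim[\![\mathcal T(E)]\!]_{\mathfrak L'}(\eta)$ for every $E\in\mathbb T_{\mathfrak L}$ and all valuations $\nu,\eta:\mathcal V\to\mathbb U$ with $\nu\sim\eta$. -}

module Defs where

open import Level using (Level; _⊔_; suc)
open import Data.Product using (Σ; ∃; _,_; proj₁)
open import Relation.Binary using (Rel; IsEquivalence)

-- A language over variables Var, with values drawn from a subclass of Z
-- (given as a predicate Val on Z, so that 𝕍 ⊆ ℤ).
record Language {v z : Level} (Var : Set v) (Z : Set z) (t p : Level)
       : Set (v ⊔ z ⊔ suc t ⊔ suc p) where
  field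
    Term : Set t
    Val  : Z → Set p
  Value : Set (z ⊔ p)
  Value = Σ Z Val
  Valuation : Set (v ⊔ z ⊔ p)
  Valuation = Var → Value
  field
    ⟦_⟧ : Term → Valuation → Value

open Language

module _ {v z ℓ : Level} {Var : Set v} {Z : Set z} (_∼_ : Rel Z ℓ) where

  _≈ᵥ_ : ∀ {p q} {P : Z → Set p} {Q : Z → Set q} → Σ Z P → Σ Z Q → Set ℓ
  a ≈ᵥ b = proj₁ a ∼ proj₁ b

  _≈val_ : ∀ {p q} {P : Z → Set p} {Q : Z → Set q}
         → (Var → Σ Z P) → (Var → Σ Z Q) → Set (v ⊔ ℓ)
  η ≈val ρ = ∀ X → η X ≈ᵥ ρ X

  Translation : ∀ {t p t' p'} → Language Var Z t p → Language Var Z t' p' → Set (t ⊔ t')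
  Translation L L' = Term L → Term L'

  CorrectUpTo : ∀ {t p t' p'} (L : Language Var Z t p) (L' : Language Var Z t' p')
              → Translation L L' → Set _
  CorrectUpTo L L' 𝒯 =
      (∀ (w : Value L) → ∃ λ (w' : Value L') → w' ≈ᵥ w)
    × (∀ (E : Term L) (η : Valuation L') (ρ : Valuation L)
       → η ≈val ρ → ⟦ L' ⟧ (𝒯 E) η ≈ᵥ ⟦ L ⟧ E ρ)
    where open import Data.Product using (_×_)

  𝕌 : ∀ {t p t' p'} (L : Language Var Z t p) (L' : Language Var Z t' p') → Z → Set _
  𝕌 L L' x = Val L' x × ∃ λ (w : Value L) → x ∼ proj₁ w
    where open import Data.Product using (_×_)

  toV' : ∀ {t p t' p'} {L : Language Var Z t p} {L' : Language Var Z t' p'}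
       → (Var → Σ Z (𝕌 L L')) → Valuation L'
  toV' ν X = proj₁ (ν X) , Data.Product.proj₁ (Data.Product.proj₂ (ν X))
    where import Data.Product

  CongruenceFor : ∀ {t p t' p'} (L : Language Var Z t p) (L' : Language Var Z t' p')
                → Translation L L' → Set _
  CongruenceFor L L' 𝒯 =
    ∀ (E : Term L) (ν η : Var → Σ Z (𝕌 L L'))
    → ν ≈val η → ⟦ L' ⟧ (𝒯 E) (toV' {L = L} {L' = L'} ν) ≈ᵥ ⟦ L' ⟧ (𝒯 E) (toV' {L = L} {L' = L'} η)

-- Every value in 𝕌 is ∼ to a source value, so a 𝕌-valuation ν has a source
-- valuation ρ (its shadow) with ν ∼ ρ, and then η ∼ ρ for any η ∼ ν.
-- Correctness makes both ⟦𝒯 E⟧ν and ⟦𝒯 E⟧η equivalent to ⟦E⟧ρ.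
module Submission where

open import Defs
open import Level using (Level)
open import Relation.Binary using (Rel; IsEquivalence)
open import Data.Product using (Σ; _,_; proj₁; proj₂)

module Shadow {v z ℓ t p t' p' : Level} {Var : Set v} {Z : Set z}
         {_∼_ : Rel Z ℓ} (∼-isEquivalence : IsEquivalence _∼_)
         (L : Language Var Z t p) (L' : Language Var Z t' p') where

  open IsEquivalence ∼-isEquivalence
  open Language using (Valuation)

  shadow : (Var → Σ Z (𝕌 _∼_ L L')) → Valuation L
  shadow ν X = proj₁ (proj₂ (proj₂ (ν X)))

  toV'-∼shadow : ∀ ν → _≈val_ _∼_ (toV' _∼_ {L = L} {L' = L'} ν) (shadow ν)
  toV'-∼shadow ν X = proj₂ (proj₂ (proj₂ (ν X)))

  toV'-∼shadow-of-∼ : ∀ ν η → _≈val_ _∼_ ν η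
                   → _≈val_ _∼_ (toV' _∼_ {L = L} {L' = L'} η) (shadow ν)
  toV'-∼shadow-of-∼ ν η ν∼η X = trans (sym (ν∼η X)) (toV'-∼shadow ν X)

proposition2 : ∀ {v z ℓ t p t' p' : Level} {Var : Set v} {Z : Set z}
    (_∼_ : Rel Z ℓ) → IsEquivalence _∼_
    → (L : Language Var Z t p) (L' : Language Var Z t' p')
    → (𝒯 : Translation _∼_ L L')
    → CorrectUpTo _∼_ L L' 𝒯
    → CongruenceFor _∼_ L L' 𝒯
proposition2 _∼_ ∼-isEquivalence L L' 𝒯 (_ , correct) E ν η ν∼η =
  trans (correct E _ (shadow ν) (toV'-∼shadow ν))
        (sym (correct E _ (shadow ν) (toV'-∼shadow-of-∼ ν η ν∼η)))
  where
    open IsEquivalence ∼-isEquivalence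
    open Shadow ∼-isEquivalence L L'
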